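{- Let $V$ be a finite nonempty set and $f:\mathbb{B}^V\to\mathbb{B}^V$ a Boolean network. If $f$ has no even-self-dual subnetwork and no odd-self-dual subnetwork, then the conjugate $\tilde f$ of $f$ is a bijection of $\mathbb{B}^V$.
   Context: $\mathbb{B}=\{0,1\}$. For $x\in\mathbb{B}^V$, $x_i$ is its $i$-component; $\oplus$ is componentwise addition mod 2; for $I\subseteq V$, $e_I$ is the point with $(e_I)_i=1$ iff $i\in I$, and $1$ denotes $e_V$. The weight $\|x\|$ is the number of $i$ with $x_i=1$; $x$ is even (resp. odd) if $\|x\|$ is even (resp. odd). A (Boolean) network on $V$ is a map $f:\mathbb{B}^V\to\mathbb{B}^V$; its conjugate is $\tilde f(x)=f(x)\oplus x$. For a nonempty $I\subseteq V$ and $z\in\mathbb{B}^{V\setminus I}$, the subnetwork of $f$ induced by $z$ is the network $h$ on $I$ defined by $h(x|_I)=f(x)|_I$ for all $x\in\mathbb{B}^V$ whose restriction to $V\setminus I$ equals $z$ (taking $I=V$, $f$ is a subnetwork of itself). A network $f$ on $V$ is self-dual if $f(x\oplus 1)=f(x)\oplus 1$ for all $x$; it is even (resp. odd) if $\tilde f(\mathbb{B}^V)$ is exactly the set of even (resp. odd) points of $\mathbb{B}^V$; it is even-self-dual (resp. odd-self-dual) if it is even (resp. odd) and self-dual. -}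

module Defs where

open import Data.Bool using (Bool; true; false; _xor_; not)
open import Data.Nat using (ℕ; zero; suc; _+_; _%_; _≤_)
open import Data.Fin using (Fin)
open import Data.Vec using (Vec; []; _∷_; zipWith; replicate; lookup; tabulate)
open import Data.Product using (Σ; ∃; _×_)
open import Relation.Binary.PropositionalEquality using (_≡_; _≢_)
open import Function.Definitions using (Injective)

-- Points of 𝔹^V, with V = Fin n, represented as vectors of booleans.
Point : ℕ → Set
Point n = Vec Bool n

Network : ℕ → Set
Network n = Point n → Point n

_⊕_ : ∀ {n} → Point n → Point n → Point n
_⊕_ = zipWith _xor_

𝟙 : ∀ {n} → Point n
𝟙 = replicate _ true

weight : ∀ {n} → Point n → ℕ
weight [] = 0
weight (true ∷ x) = suc (weight x)
weight (false ∷ x) = weight x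

IsEvenPoint : ∀ {n} → Point n → Set
IsEvenPoint x = weight x % 2 ≡ 0

IsOddPoint : ∀ {n} → Point n → Set
IsOddPoint x = weight x % 2 ≡ 1

conj : ∀ {n} → Network n → Network n
conj f x = f x ⊕ x

SelfDual : ∀ {n} → Network n → Set
SelfDual f = ∀ x → f (x ⊕ 𝟙) ≡ f x ⊕ 𝟙

IsEvenNet : ∀ {n} → Network n → Set
IsEvenNet f = (∀ x → IsEvenPoint (conj f x))
            × (∀ y → IsEvenPoint y → ∃ λ x → conj f x ≡ y)

IsOddNet : ∀ {n} → Network n → Set
IsOddNet f = (∀ x → IsOddPoint (conj f x))
           × (∀ y → IsOddPoint y → ∃ λ x → conj f x ≡ y)

EvenSelfDual : ∀ {n} → Network n → Set
EvenSelfDual f = IsEvenNet f × SelfDual f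

OddSelfDual : ∀ {n} → Network n → Set
OddSelfDual f = IsOddNet f × SelfDual f

-- h (a network on Fin k) is a subnetwork of f (a network on Fin n):
-- there is a nonempty I ⊆ Fin n, enumerated by an injection e : Fin k → Fin n
-- (so I = image of e, k ≥ 1), and a configuration z, such that for every
-- x ∈ 𝔹^V agreeing with z outside I, h(x|_I) = f(x)|_I.
-- (Only the values of z outside I matter.)
restrict : ∀ {k n} → (Fin k → Fin n) → Point n → Point k
restrict e x = tabulate (λ j → lookup x (e j))

IsSubnetwork : ∀ {n k} → Network n → Network k → Set
IsSubnetwork {n} {k} f h =
  1 ≤ k ×
  Σ (Fin k → Fin n) λ e → Injective _≡_ _≡_ e ×
  Σ (Point n) λ z →
    ∀ (x : Point n) →
      (∀ (i : Fin n) → (∀ (j : Fin k) → e j ≢ i) → lookup x i ≡ lookup z i) →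
      h (restrict e x) ≡ restrict e (f x)

IsBijection : ∀ {n} → (Point n → Point n) → Set
IsBijection g = Injective _≡_ _≡_ g × (∀ y → ∃ λ x → g x ≡ y)

-- Induction on |V|. Fixing one coordinate of f gives a subnetwork whose conjugate is
-- bijective by induction, so f̃ is injective on each facet of the cube up to the fixed
-- coordinate; hence two points with the same f̃-image are equal or antipodal. Call y
-- doubly hit if y = f̃(w) = f̃(w ⊕ 1). Every neighbour of a doubly hit point is missed,
-- and every neighbour of a missed point is doubly hit. So if some point is doubly hit,
-- the doubly hit points form one parity class and all others are missed: then f̃
-- identifies antipodal points (f is self-dual) and its image is that parity class, so f
-- is itself even- or odd-self-dual. Otherwise f̃ is injective, and also surjective,
-- since a missed point would have a doubly hit neighbour.
module Submission where

open import Defs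
open import Data.Bool using (Bool; true; false; not; _xor_; if_then_else_)
open import Data.Bool.Properties
  using (¬-not; not-¬; not-involutive; not-distribˡ-xor; not-distribʳ-xor; xor-same)
  renaming (_≟_ to _≟ᴮ_)
open import Data.Empty using (⊥-elim)
open import Data.Fin using (Fin; zero; suc; punchIn)
open import Data.Fin.Properties using (punchInᵢ≢i; punchOut-punchIn; punchIn-injective)
open import Data.Nat using (ℕ; zero; suc; _%_; _≤_; s≤s; z≤n)
open import Data.Product using (Σ; ∃; _×_; _,_; proj₁; proj₂)
open import Data.Sum using (_⊎_; inj₁; inj₂)
open import Data.Vec using (Vec; []; _∷_; lookup; replicate; insertAt; removeAt; updateAt)
open import Data.Vec.Properties
  using (∷-injectiveˡ; ∷-injectiveʳ; ≡-dec; lookup-zipWith; lookup∘updateAt; lookup∘updateAt′;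
         tabulate∘lookup; tabulate-cong; insertAt-lookup; insertAt-punchIn;
         removeAt-punchOut; removeAt-insertAt; insertAt-removeAt)
open import Data.Vec.Relation.Binary.Pointwise.Extensional using (ext; Pointwise-≡⇒≡)
open import Function using (_∘_)
open import Function.Definitions using (Injective)
open import Relation.Nullary using (¬_; yes; no)
open import Relation.Binary.PropositionalEquality

bit : Bool → ℕ
bit b = if b then 1 else 0

bit-injective : ∀ {a b} → bit a ≡ bit b → a ≡ b
bit-injective {false} {false} _ = refl
bit-injective {true}  {true}  _ = refl

parity : ∀ {n} → Point n → Bool
parity []      = false
parity (b ∷ x) = b xor parity x

suc-%2 : ∀ w b → w % 2 ≡ bit b → suc w % 2 ≡ bit (not b)
suc-%2 0             false _ = refl
suc-%2 1             true  _ = refl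
suc-%2 (suc (suc w)) b     p = suc-%2 w b p  -- (2 + w) % 2 reduces to w % 2

weight-%2 : ∀ {n} (x : Point n) → weight x % 2 ≡ bit (parity x)
weight-%2 []          = refl
weight-%2 (true ∷ x)  = suc-%2 (weight x) (parity x) (weight-%2 x)
weight-%2 (false ∷ x) = weight-%2 x

weight-%2⇒parity : ∀ {n b} (x : Point n) → weight x % 2 ≡ bit b → parity x ≡ b
weight-%2⇒parity x p = bit-injective (trans (sym (weight-%2 x)) p)

parity⇒weight-%2 : ∀ {n b} (x : Point n) → parity x ≡ b → weight x % 2 ≡ bit b
parity⇒weight-%2 x p = trans (weight-%2 x) (cong bit p)

xor≡false⇒≡ : ∀ {a b} → a xor b ≡ false → a ≡ b
xor≡false⇒≡ {false} {false} _ = refl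
xor≡false⇒≡ {true}  {true}  _ = refl

xor-trueʳ : ∀ a → a xor true ≡ not a
xor-trueʳ false = refl
xor-trueʳ true  = refl

lookup-⊕𝟙 : ∀ {n} (x : Point n) i → lookup (x ⊕ 𝟙) i ≡ not (lookup x i)
lookup-⊕𝟙 (a ∷ x) zero    = xor-trueʳ a
lookup-⊕𝟙 (a ∷ x) (suc i) = lookup-⊕𝟙 x i

agree-somewhere-or-antipodal : ∀ {n} (x x' : Point n) →
  (∃ λ i → lookup x i ≡ lookup x' i) ⊎ x' ≡ x ⊕ 𝟙
agree-somewhere-or-antipodal []      []        = inj₂ refl
agree-somewhere-or-antipodal (a ∷ x) (a' ∷ x') with a ≟ᴮ a' | agree-somewhere-or-antipodal x x'
... | yes p | _              = inj₁ (zero , p)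
... | no _  | inj₁ (i , q)   = inj₁ (suc i , q)
... | no p  | inj₂ q         = inj₂ (cong₂ _∷_ (trans (¬-not (p ∘ sym)) (sym (xor-trueʳ a))) q)

flipAt : ∀ {n} → Fin n → Point n → Point n
flipAt i y = updateAt y i not

flipAt-≢ : ∀ {n} (i : Fin n) y → y ≢ flipAt i y
flipAt-≢ i y e = not-¬ refl (trans (cong (λ z → lookup z i) e) (lookup∘updateAt i y))

lookup-removeAt : ∀ {n} {A : Set} (xs : Vec A (suc n)) i j →
  lookup (removeAt xs i) j ≡ lookup xs (punchIn i j)
lookup-removeAt xs i j =
  trans (cong (lookup (removeAt xs i)) (sym (punchOut-punchIn i)))
        (removeAt-punchOut xs (punchInᵢ≢i i j ∘ sym))

removeAt-flipAt : ∀ {n} (i : Fin (suc n)) y → removeAt (flipAt i y) i ≡ removeAt y i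
removeAt-flipAt i y = Pointwise-≡⇒≡ (ext λ j → begin
  lookup (removeAt (flipAt i y) i) j  ≡⟨ lookup-removeAt (flipAt i y) i j ⟩
  lookup (flipAt i y) (punchIn i j)   ≡⟨ lookup∘updateAt′ (punchIn i j) i (punchInᵢ≢i i j) y ⟩
  lookup y (punchIn i j)              ≡⟨ lookup-removeAt y i j ⟨
  lookup (removeAt y i) j             ∎)
  where open ≡-Reasoning

removeAt-⊕ : ∀ {n} (x y : Point (suc n)) i → removeAt (x ⊕ y) i ≡ removeAt x i ⊕ removeAt y i
removeAt-⊕ x y i = Pointwise-≡⇒≡ (ext λ j → begin
  lookup (removeAt (x ⊕ y) i) j                         ≡⟨ lookup-removeAt (x ⊕ y) i j ⟩
  lookup (x ⊕ y) (punchIn i j)                          ≡⟨ lookup-zipWith _xor_ (punchIn i j) x y ⟩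
  lookup x (punchIn i j) xor lookup y (punchIn i j)     ≡⟨ cong₂ _xor_ (lookup-removeAt x i j) (lookup-removeAt y i j) ⟨
  lookup (removeAt x i) j xor lookup (removeAt y i) j   ≡⟨ lookup-zipWith _xor_ j (removeAt x i) (removeAt y i) ⟨
  lookup (removeAt x i ⊕ removeAt y i) j                ∎)
  where open ≡-Reasoning

removeAt-lookup-injective : ∀ {n} {i : Fin (suc n)} {x x' : Point (suc n)} →
  lookup x i ≡ lookup x' i → removeAt x i ≡ removeAt x' i → x ≡ x'
removeAt-lookup-injective {i = i} {x} {x'} p q = begin
  x                                      ≡⟨ insertAt-removeAt x i ⟨
  insertAt (removeAt x i) i (lookup x i) ≡⟨ cong₂ (λ v b → insertAt v i b) q p ⟩
  insertAt (removeAt x' i) i (lookup x' i) ≡⟨ insertAt-removeAt x' i ⟩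
  x'                                     ∎
  where open ≡-Reasoning

removeAt-≡ : ∀ {n} {i : Fin (suc n)} {x y : Point (suc n)} →
  removeAt x i ≡ removeAt y i → x ≡ y ⊎ x ≡ flipAt i y
removeAt-≡ {i = i} {x} {y} q with lookup x i ≟ᴮ lookup y i
... | yes p = inj₁ (removeAt-lookup-injective p q)
... | no p  = inj₂ (removeAt-lookup-injective
                     (trans (¬-not p) (sym (lookup∘updateAt i y)))
                     (trans q (sym (removeAt-flipAt i y))))

parity-induction : ∀ {n} (P : Bool → Point n → Set) →
  (∀ {b y} i → P b y → P (not b) (flipAt i y)) →
  ∀ {c} → P false c → ∀ y → P (parity y xor parity c) y
parity-induction P step {[]} pc [] = pc
parity-induction P step {a₀ ∷ c} pc (a ∷ y) =
  head-step a₀ a (parity-induction (λ b v → P b (a₀ ∷ v)) (step ∘ suc) pc y)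
  where
  p = parity y
  q = parity c
  head-step : ∀ a₀ a → P (p xor q) (a₀ ∷ y) → P ((a xor p) xor (a₀ xor q)) (a ∷ y)
  head-step false false s = s
  head-step false true  s = subst (λ b → P b (true ∷ y)) (not-distribˡ-xor p q) (step zero s)
  head-step true  false s = subst (λ b → P b (false ∷ y)) (not-distribʳ-xor p q) (step zero s)
  head-step true  true  s = subst (λ b → P b (true ∷ y)) p⊕q≡¬p⊕¬q s
    where
    p⊕q≡¬p⊕¬q : p xor q ≡ not p xor not q
    p⊕q≡¬p⊕¬q = trans (sym (not-involutive (p xor q)))
                  (trans (cong not (not-distribʳ-xor p q)) (not-distribˡ-xor p (not q)))

AntipodalInvariant : ∀ {n} → (Point n → Point n) → Set
AntipodalInvariant G = ∀ x → G (x ⊕ 𝟙) ≡ G x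

-- For G = conj f this is IsEvenNet f when p = false and IsOddNet f when p = true.
ImageIsParityClass : ∀ {n} → (Point n → Point n) → Bool → Set
ImageIsParityClass G p =
  (∀ x → weight (G x) % 2 ≡ bit p) × (∀ y → weight y % 2 ≡ bit p → ∃ λ x → G x ≡ y)

⊕-antipodal-cancel : ∀ {n} (a b c : Point n) → a ⊕ (b ⊕ 𝟙) ≡ c ⊕ b → a ≡ c ⊕ 𝟙
⊕-antipodal-cancel []      []      []      _ = refl
⊕-antipodal-cancel (a ∷ x) (b ∷ y) (c ∷ z) e =
  cong₂ _∷_ (cancel a b c (∷-injectiveˡ e)) (⊕-antipodal-cancel x y z (∷-injectiveʳ e))
  where
  cancel : ∀ a b c → a xor (b xor true) ≡ c xor b → a ≡ c xor true
  cancel false false true  _ = refl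
  cancel false true  true  _ = refl
  cancel true  false false _ = refl
  cancel true  true  false _ = refl
  cancel false false false ()
  cancel false true  false ()
  cancel true  false true  ()
  cancel true  true  true  ()

antipodal-conj⇒self-dual : ∀ {n} (f : Network n) → AntipodalInvariant (conj f) → SelfDual f
antipodal-conj⇒self-dual f anti x = ⊕-antipodal-cancel (f (x ⊕ 𝟙)) x (f x) (anti x)

IsBijection-≗ : ∀ {n} {g h : Point n → Point n} → IsBijection g → g ≗ h → IsBijection h
IsBijection-≗ {g = g} {h} (g-inj , g-surj) g≗h = h-inj , h-surj
  where
  h-inj : Injective _≡_ _≡_ h
  h-inj {x} {y} e = g-inj (trans (g≗h x) (trans e (sym (g≗h y))))
  h-surj : ∀ y → ∃ λ x → h x ≡ y
  h-surj y with g-surj y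
  ... | x , p = x , trans (sym (g≗h x)) p

face : ∀ {m} → Fin (suc m) → Bool → (Point (suc m) → Point (suc m)) → Point m → Point m
face i b G w = removeAt (G (insertAt w i b)) i

conj-face : ∀ {m} i b (f : Network (suc m)) → conj (face i b f) ≗ face i b (conj f)
conj-face i b f w = begin
  removeAt (f v) i ⊕ w                 ≡⟨ cong (removeAt (f v) i ⊕_) (removeAt-insertAt w i b) ⟨
  removeAt (f v) i ⊕ removeAt v i      ≡⟨ removeAt-⊕ (f v) v i ⟨
  removeAt (f v ⊕ v) i                 ∎
  where
  open ≡-Reasoning
  v = insertAt w i b

restrict-removeAt : ∀ {m k} (i : Fin (suc m)) (e : Fin k → Fin m) x →
  restrict e (removeAt x i) ≡ restrict (punchIn i ∘ e) x
restrict-removeAt i e x = tabulate-cong λ j → lookup-removeAt x i (e j)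

face-subnetwork : ∀ {m k} {i : Fin (suc m)} {b} {f : Network (suc m)} {h : Network k} →
  IsSubnetwork (face i b f) h → IsSubnetwork f h
face-subnetwork {m} {k} {i} {b} {f} {h} (1≤k , e , e-injective , z , h-induced) =
  1≤k , punchIn i ∘ e , e-injective ∘ punchIn-injective i _ _ , insertAt z i b , induced
  where
  induced : ∀ x → (∀ l → (∀ j → punchIn i (e j) ≢ l) → lookup x l ≡ lookup (insertAt z i b) l) →
            h (restrict (punchIn i ∘ e) x) ≡ restrict (punchIn i ∘ e) (f x)
  induced x outside = begin
    h (restrict (punchIn i ∘ e) x)    ≡⟨ cong h (restrict-removeAt i e x) ⟨
    h (restrict e w)                  ≡⟨ h-induced w outside-w ⟩
    restrict e (face i b f w)         ≡⟨ cong (λ v → restrict e (removeAt (f v) i)) x≡w+b ⟩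
    restrict e (removeAt (f x) i)     ≡⟨ restrict-removeAt i e (f x) ⟩
    restrict (punchIn i ∘ e) (f x)    ∎
    where
    open ≡-Reasoning
    w = removeAt x i
    x≡w+b : insertAt w i b ≡ x
    x≡w+b = trans (cong (insertAt w i)
                    (sym (trans (outside i (λ j → punchInᵢ≢i i (e j))) (insertAt-lookup z i b))))
                  (insertAt-removeAt x i)
    outside-w : ∀ l → (∀ j → e j ≢ l) → lookup w l ≡ lookup z l
    outside-w l l∉e = begin
      lookup w l                          ≡⟨ lookup-removeAt x i l ⟩
      lookup x (punchIn i l)              ≡⟨ outside (punchIn i l) (λ j → l∉e j ∘ punchIn-injective i _ _) ⟩
      lookup (insertAt z i b) (punchIn i l) ≡⟨ insertAt-punchIn z i b l ⟩
      lookup z l                          ∎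

self-subnetwork : ∀ {m} (f : Network (suc m)) → IsSubnetwork f f
self-subnetwork f = s≤s z≤n , (λ j → j) , (λ p → p) , replicate _ false ,
  λ x _ → trans (cong f (tabulate∘lookup x)) (sym (tabulate∘lookup (f x)))

module FacesBijective {m} (G : Point (suc m) → Point (suc m))
                      (faces-bijective : ∀ i b → IsBijection (face i b G)) where

  injective-on-facets : ∀ i {x x'} → lookup x i ≡ lookup x' i →
    removeAt (G x) i ≡ removeAt (G x') i → x ≡ x'
  injective-on-facets i {x} {x'} p e = removeAt-lookup-injective p
    (proj₁ (faces-bijective i (lookup x i)) (begin
      face i (lookup x i) G (removeAt x i)    ≡⟨ cong (λ v → removeAt (G v) i) (insertAt-removeAt x i) ⟩
      removeAt (G x) i                        ≡⟨ e ⟩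
      removeAt (G x') i                       ≡⟨ cong (λ v → removeAt (G v) i) (insertAt-removeAt x' i) ⟨
      face i (lookup x' i) G (removeAt x' i)  ≡⟨ cong (λ b → face i b G (removeAt x' i)) p ⟨
      face i (lookup x i) G (removeAt x' i)   ∎))
    where open ≡-Reasoning

  surjective-on-facets : ∀ i b y → ∃ λ x → lookup x i ≡ b × removeAt (G x) i ≡ y
  surjective-on-facets i b y with proj₂ (faces-bijective i b) y
  ... | w , p = insertAt w i b , insertAt-lookup w i b , p

  collision : ∀ {x x'} → G x ≡ G x' → x ≡ x' ⊎ x' ≡ x ⊕ 𝟙
  collision {x} {x'} e with agree-somewhere-or-antipodal x x'
  ... | inj₁ (i , p) = inj₁ (injective-on-facets i p (cong (λ y → removeAt y i) e))
  ... | inj₂ q       = inj₂ q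

  DoublyHit : Point (suc m) → Set
  DoublyHit y = ∃ λ w → G w ≡ y × G (w ⊕ 𝟙) ≡ y

  Missed : Point (suc m) → Set
  Missed y = ∀ w → G w ≢ y

  no-flip-neighbour : ∀ i {u v y} → lookup v i ≡ lookup u i → G v ≡ y → G u ≢ flipAt i y
  no-flip-neighbour i {u} {v} {y} s p r
    with injective-on-facets i s (begin
           removeAt (G v) i            ≡⟨ cong (λ z → removeAt z i) p ⟩
           removeAt y i                ≡⟨ removeAt-flipAt i y ⟨
           removeAt (flipAt i y) i     ≡⟨ cong (λ z → removeAt z i) r ⟨
           removeAt (G u) i            ∎)
    where open ≡-Reasoning
  ... | refl = flipAt-≢ i y (trans (sym p) r)

  doublyHit⇒flip-missed : ∀ {y} → DoublyHit y → ∀ i → Missed (flipAt i y)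
  doublyHit⇒flip-missed (w , p , q) i u with lookup w i ≟ᴮ lookup u i
  ... | yes s = no-flip-neighbour i s p
  ... | no s  = no-flip-neighbour i (trans (lookup-⊕𝟙 w i) (sym (¬-not (s ∘ sym)))) q

  hit-or-flip-doublyHit : ∀ i y → (∃ λ w → G w ≡ y) ⊎ DoublyHit (flipAt i y)
  hit-or-flip-doublyHit i y
    with surjective-on-facets i false (removeAt y i) | surjective-on-facets i true (removeAt y i)
  ... | a , aᵢ , ra | a' , a'ᵢ , ra' with removeAt-≡ ra | removeAt-≡ ra'
  ... | inj₁ e | _      = inj₁ (a , e)
  ... | inj₂ _ | inj₁ e = inj₁ (a' , e)
  ... | inj₂ e | inj₂ e' with collision (trans e (sym e'))
  ...   | inj₂ antipodal = inj₂ (a , e , trans (cong G (sym antipodal)) e')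
  ...   | inj₁ refl with trans (sym aᵢ) a'ᵢ
  ...     | ()

  Status : Bool → Point (suc m) → Set
  Status false = DoublyHit
  Status true  = Missed

  status-flip : ∀ {b y} i → Status b y → Status (not b) (flipAt i y)
  status-flip {false}     i s = doublyHit⇒flip-missed s i
  status-flip {true}  {y} i s with hit-or-flip-doublyHit i y
  ... | inj₁ (w , p) = ⊥-elim (s w p)
  ... | inj₂ d       = d

  hit⇒status-false : ∀ {b y} → Status b y → (∃ λ w → G w ≡ y) → b ≡ false
  hit⇒status-false {false} _ _       = refl
  hit⇒status-false {true}  s (w , p) = ⊥-elim (s w p)

  module _ {c} (c-doublyHit : DoublyHit c) where

    status : ∀ y → Status (parity y xor parity c) y
    status = parity-induction Status (λ {b} {y} → status-flip {b} {y}) c-doublyHit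

    image-status : ∀ w → parity (G w) xor parity c ≡ false
    image-status w = hit⇒status-false (status (G w)) (w , refl)

    image-parity : ∀ w → parity (G w) ≡ parity c
    image-parity w = xor≡false⇒≡ (image-status w)

    antipodal-invariant : AntipodalInvariant G
    antipodal-invariant w with subst (λ b → Status b (G w)) (image-status w) (status (G w))
    ... | u , p , q with collision (sym p)
    ...   | inj₁ refl = q
    ...   | inj₂ r    = trans (cong G (sym r)) p

    parity-class-hit : ∀ y → parity y ≡ parity c → ∃ λ x → G x ≡ y
    parity-class-hit y e
      with subst (λ b → Status b y) (trans (cong (_xor parity c) e) (xor-same (parity c))) (status y)
    ... | u , p , _ = u , p

    image-is-parity-class : ImageIsParityClass G (parity c)
    image-is-parity-class =
      (λ x → parity⇒weight-%2 (G x) (image-parity x)) ,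
      (λ y p → parity-class-hit y (weight-%2⇒parity y p))

  bijective-or-antipodal : IsBijection G ⊎ (AntipodalInvariant G × Σ Bool (ImageIsParityClass G))
  bijective-or-antipodal with ≡-dec _≟ᴮ_ (G (o ⊕ 𝟙)) (G o)
    where o = replicate _ false
  ... | yes e = inj₂ (antipodal-invariant d , parity (G _) , image-is-parity-class d)
    where d = _ , refl , e
  ... | no ne = inj₁ (injective , surjective)
    where
    injective : Injective _≡_ _≡_ G
    injective {x} {x'} e with collision e
    ... | inj₁ p = p
    ... | inj₂ q = ⊥-elim (ne (antipodal-invariant (x , refl , trans (cong G (sym q)) (sym e)) _))
    surjective : ∀ y → ∃ λ x → G x ≡ y
    surjective y with hit-or-flip-doublyHit zero y
    ... | inj₁ h = h
    ... | inj₂ d = ⊥-elim (ne (antipodal-invariant d _))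

NoSubnetwork : (∀ {k} → Network k → Set) → ∀ {n} → Network n → Set
NoSubnetwork P f = ∀ k (h : Network k) → IsSubnetwork f h → ¬ P h

face-no-subnetwork : ∀ {P : ∀ {k} → Network k → Set} {m} i b (f : Network (suc m)) →
  NoSubnetwork P f → NoSubnetwork P (face i b f)
face-no-subnetwork i b f noP k h sub = noP k h (face-subnetwork {i = i} {b} {f} {h} sub)

conj-bijective : ∀ n (f : Network n) →
  NoSubnetwork EvenSelfDual f → NoSubnetwork OddSelfDual f → IsBijection (conj f)
conj-bijective zero f _ _ = (λ { {[]} {[]} _ → refl }) , λ { [] → [] , point₀ (conj f []) }
  where
  point₀ : (x : Point 0) → x ≡ []
  point₀ [] = refl
conj-bijective (suc m) f noEven noOdd
  with FacesBijective.bijective-or-antipodal (conj f) faces-bijective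
  where
  faces-bijective : ∀ i b → IsBijection (face i b (conj f))
  faces-bijective i b = IsBijection-≗
    (conj-bijective m (face i b f) (face-no-subnetwork i b f noEven) (face-no-subnetwork i b f noOdd))
    (conj-face i b f)
... | inj₁ bijective = bijective
... | inj₂ (antipodal , false , image) =
  ⊥-elim (noEven _ f (self-subnetwork f) (image , antipodal-conj⇒self-dual f antipodal))
... | inj₂ (antipodal , true , image) =
  ⊥-elim (noOdd _ f (self-subnetwork f) (image , antipodal-conj⇒self-dual f antipodal))

theorem8 : (n : ℕ) → 1 ≤ n → (f : Network n) →
    (∀ (k : ℕ) (h : Network k) → IsSubnetwork f h → ¬ EvenSelfDual h) →
    (∀ (k : ℕ) (h : Network k) → IsSubnetwork f h → ¬ OddSelfDual h) →
    IsBijection (conj f)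
theorem8 n _ f = conj-bijective n f
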